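{- For each prime $p$ let $S_p$ be the set of $p$-practical positive integers. Then $\bigcup_{p \text{ prime}} S_p = \mathbb{Z}_{>0}$; that is, every positive integer is $p$-practical for some prime $p$.
   Context: For a prime $p$, a positive integer $n$ is $p$-practical if the polynomial $x^n-1$ has a divisor in $\mathbb{F}_p[x]$ of every degree $1,2,\dots,n$. -}

module Defs where

open import Data.Nat using (ℕ; zero; suc; _≤_)
open import Data.Nat.Primality using (Prime)
open import Data.Integer as ℤ using (ℤ; +_; _-_)
open import Data.Integer.Divisibility as ℤDiv using ()
open import Data.List using (List; []; _∷_; map)
open import Data.Vec using (Vec; toList; last)
open import Data.Product using (Σ; _×_)
open import Relation.Nullary using (¬_)

-- Polynomials with integer coefficients, as coefficient lists
-- (constant term first).  A polynomial over 𝔽_p is represented by any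
-- integer lift of its coefficients; equality in 𝔽_p[x] is coefficientwise
-- congruence modulo p.
Poly : Set
Poly = List ℤ

coeff : Poly → ℕ → ℤ
coeff []       _       = + 0
coeff (a ∷ f)  zero    = a
coeff (a ∷ f)  (suc k) = coeff f k

_⊕_ : Poly → Poly → Poly
[]      ⊕ g       = g
(a ∷ f) ⊕ []      = a ∷ f
(a ∷ f) ⊕ (b ∷ g) = (a ℤ.+ b) ∷ (f ⊕ g)

_⊛_ : Poly → Poly → Poly
[]      ⊛ g = []
(a ∷ f) ⊛ g = map (a ℤ.*_) g ⊕ (+ 0 ∷ (f ⊛ g))

xⁿ-1 : ℕ → ℕ → ℤ
xⁿ-1 n k = xn n k - one k
  where
  xn : ℕ → ℕ → ℤ
  xn zero    zero    = + 1
  xn zero    (suc _) = + 0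
  xn (suc _) zero    = + 0
  xn (suc m) (suc j) = xn m j
  one : ℕ → ℤ
  one zero    = + 1
  one (suc _) = + 0

DividesXⁿ-1 : ℕ → ℕ → Poly → Set
DividesXⁿ-1 p n g =
  Σ Poly λ h → ∀ k → (+ p) ℤDiv.∣ (coeff (g ⊛ h) k - xⁿ-1 n k)

HasDivisorOfDegree : ℕ → ℕ → ℕ → Set
HasDivisorOfDegree p n d =
  Σ (Vec ℤ (suc d)) λ g →
    (¬ ((+ p) ℤDiv.∣ last g)) × DividesXⁿ-1 p n (toList g)

PPractical : ℕ → ℕ → Set
PPractical p n = ∀ d → 1 ≤ d → d ≤ n → HasDivisorOfDegree p n d

{-# OPTIONS --safe #-}
module Submission where

-- Write n = m · p with p the largest prime factor of n, so that every prime factor of m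
-- is at most p.  In 𝔽ₚ[x] the Frobenius endomorphism gives xⁿ − 1 = (xᵐ − 1)ᵖ, so it
-- suffices that (xᵐ − 1)ᴹ has a monic divisor of every degree up to mM whenever m is a
-- product of integers in [2, M] (for n = 1 take m = M = 1 and any p).  By induction on
-- such a product m = l · a: xᵐ − 1 = (xᵃ − 1) · G with G = 1 + xᵃ + ⋯ + x^(a(l−1)) monic
-- of degree c = a(l − 1) ≤ aM, hence (xᵐ − 1)ᴹ = (xᵃ − 1)ᴹ · Gᴹ; a degree d ≤ mM = aM + Mc
-- is r + jc with r ≤ aM and j ≤ M, and g · Gʲ is a divisor of degree d whenever g is a
-- monic divisor of (xᵃ − 1)ᴹ of degree r.

open import Defs
open import Algebra.Bundles using (CommutativeRing)
open import Algebra.Structures using (IsCommutativeRing)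
open import Data.Empty using (⊥-elim)
open import Data.Fin.Base using (zero; suc; toℕ; fromℕ; inject₁)
open import Data.Fin.Properties using (toℕ<n; toℕ-fromℕ; toℕ-inject₁)
open import Data.List.Base using ([]; _∷_; map)
open import Data.List.Relation.Unary.All using (All; []; _∷_)
open import Data.Nat.Base as ℕ using (ℕ; zero; suc; _<_; _≤_; _∸_; z≤n; s≤s)
open import Data.Nat.Combinatorics using (_C_; nCn≡1; nC1≡n; nCk+nC[k+1]≡[n+1]C[k+1])
import Data.Nat.Divisibility as ℕ∣
open import Data.Nat.ListAction using (product)
open import Data.Nat.Primality using (Prime; euclidsLemma; prime[2]; prime⇒nonTrivial; ¬prime[1])
open import Data.Nat.Primality.Factorisation using (factorise)
open import Data.Nat.Properties as ℕP using ()
import Data.Nat.Tactic.RingSolver as ℕSolver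
open import Data.Product.Base using (Σ; ∃₂; _×_; _,_)
open import Data.Sum.Base using (inj₁; inj₂)
open import Data.Vec.Base using (Vec; []; _∷_; toList; last)
open import Function.Base using (_∘_)
open import Level using (0ℓ)
open import Relation.Binary.PropositionalEquality as ≡
  using (_≡_; refl; cong; cong₂; subst; subst₂; module ≡-Reasoning)
open import Relation.Nullary.Decidable using (yes; no)
open import Relation.Nullary.Negation using (¬_)
import Algebra.Properties.CommutativeSemigroup ℕP.+-commutativeSemigroup as ℕ+

[k+1]*[n+1]C[k+1]≡[n+1]*nCk : ∀ n k → suc k ℕ.* (suc n C suc k) ≡ suc n ℕ.* (n C k)
[k+1]*[n+1]C[k+1]≡[n+1]*nCk zero    zero    = refl
[k+1]*[n+1]C[k+1]≡[n+1]*nCk zero    (suc k) = ℕP.*-zeroʳ (suc (suc k))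
[k+1]*[n+1]C[k+1]≡[n+1]*nCk (suc n) zero    =
  ≡.trans (ℕP.+-identityʳ _) (≡.trans (nC1≡n (suc (suc n))) (≡.sym (ℕP.*-identityʳ _)))
[k+1]*[n+1]C[k+1]≡[n+1]*nCk (suc n) (suc k) = begin
  suc (suc k) ℕ.* (suc (suc n) C suc (suc k))
    ≡⟨ cong (suc (suc k) ℕ.*_) (nCk+nC[k+1]≡[n+1]C[k+1] (suc n) (suc k)) ⟨
  suc (suc k) ℕ.* (a ℕ.+ b)
    ≡⟨ regroup k a b ⟩
  a ℕ.+ (suc k ℕ.* a ℕ.+ suc (suc k) ℕ.* b)
    ≡⟨ cong (a ℕ.+_) (cong₂ ℕ._+_ ([k+1]*[n+1]C[k+1]≡[n+1]*nCk n k) ([k+1]*[n+1]C[k+1]≡[n+1]*nCk n (suc k))) ⟩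
  a ℕ.+ (suc n ℕ.* (n C k) ℕ.+ suc n ℕ.* (n C suc k))
    ≡⟨ cong (a ℕ.+_) (ℕP.*-distribˡ-+ (suc n) (n C k) _) ⟨
  a ℕ.+ suc n ℕ.* (n C k ℕ.+ n C suc k)
    ≡⟨ cong (λ c → a ℕ.+ suc n ℕ.* c) (nCk+nC[k+1]≡[n+1]C[k+1] n k) ⟩
  a ℕ.+ suc n ℕ.* a ∎
  where
  open ≡-Reasoning
  a b : ℕ
  a = suc n C suc k
  b = suc n C suc (suc k)
  regroup : ∀ k a b → suc (suc k) ℕ.* (a ℕ.+ b) ≡ a ℕ.+ (suc k ℕ.* a ℕ.+ suc (suc k) ℕ.* b)
  regroup = ℕSolver.solve-∀

prime∣pCk : ∀ {p k} → Prime p → 0 < k → k < p → p ℕ∣.∣ (p C k)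
prime∣pCk {suc n} {suc k} p-prime _ k<p
  with euclidsLemma (suc k) (suc n C suc k) p-prime
         (subst (suc n ℕ∣.∣_) (≡.sym ([k+1]*[n+1]C[k+1]≡[n+1]*nCk n k)) (ℕ∣.m∣m*n (n C k)))
... | inj₂ p∣pCk = p∣pCk
... | inj₁ p∣k+1 = ⊥-elim (ℕP.<⇒≱ k<p (ℕ∣.∣⇒≤ p∣k+1))

module CommutativeRingProperties {c ℓ} (R : CommutativeRing c ℓ) where

  open CommutativeRing R hiding (zero) renaming (refl to ≈-refl)
  open import Algebra.Properties.Semiring.Exp semiring using (_^_)
  open import Algebra.Properties.Semiring.Mult semiring as Mult using (×-congˡ; ×-homo-1; ×-assocˡ)
  open import Algebra.Properties.CommutativeSemiring.Binomial commutativeSemiring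
    using (binomialTerm; theorem)
  open import Algebra.Properties.Monoid.Sum +-monoid using (sum; sum-cong-≋; sum-replicate-zero; sum-init-last)
  open import Algebra.Properties.Group +-group using (inverseʳ-unique)
  open import Algebra.Properties.Ring ring using (x[y-z]≈xy-xz)
  open import Algebra.Properties.AbelianGroup +-abelianGroup using (xyx⁻¹≈y)
  open import Algebra.Properties.CommutativeSemigroup *-commutativeSemigroup using (x∙yz≈y∙xz)
  open import Relation.Binary.Reasoning.Setoid setoid

  geometricSum : Carrier → ℕ → Carrier
  geometricSum y zero    = 1#
  geometricSum y (suc k) = 1# + y * geometricSum y k

  [y-1]*geometricSum≈y^[1+k]-1 : ∀ y k → (y - 1#) * geometricSum y k ≈ y ^ suc k - 1#
  [y-1]*geometricSum≈y^[1+k]-1 y zero    = trans (*-identityʳ _) (+-congʳ (sym (*-identityʳ y)))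
  [y-1]*geometricSum≈y^[1+k]-1 y (suc k) = begin
    (y - 1#) * (1# + y * g)                     ≈⟨ distribˡ (y - 1#) 1# (y * g) ⟩
    (y - 1#) * 1# + (y - 1#) * (y * g)          ≈⟨ +-cong (*-identityʳ _) (x∙yz≈y∙xz (y - 1#) y g) ⟩
    (y - 1#) + y * ((y - 1#) * g)               ≈⟨ +-congˡ (*-congˡ ([y-1]*geometricSum≈y^[1+k]-1 y k)) ⟩
    (y - 1#) + y * (y ^ suc k - 1#)             ≈⟨ +-congˡ (trans (x[y-z]≈xy-xz y _ 1#) (+-congˡ (-‿cong (*-identityʳ y)))) ⟩
    (y - 1#) + (y * y ^ suc k - y)              ≈⟨ +-assoc (y - 1#) _ _ ⟨
    (y - 1#) + y * y ^ suc k - y                ≈⟨ +-congʳ (+-assoc y (- 1#) _) ⟩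
    y + (- 1# + y * y ^ suc k) - y              ≈⟨ xyx⁻¹≈y y _ ⟩
    - 1# + y * y ^ suc k                        ≈⟨ +-comm _ _ ⟩
    y * y ^ suc k - 1#                          ∎
    where g = geometricSum y k

  1#^n≈1# : ∀ n → 1# ^ n ≈ 1#
  1#^n≈1# zero    = ≈-refl
  1#^n≈1# (suc n) = trans (*-identityˡ _) (1#^n≈1# n)

  ∣⇒×≈0# : ∀ {p m} → (∀ z → p Mult.× z ≈ 0#) → p ℕ∣.∣ m → ∀ z → m Mult.× z ≈ 0#
  ∣⇒×≈0# {p} {m} char (ℕ∣.divides q m≡q*p) z = begin
    m Mult.× z             ≈⟨ ×-congˡ (≡.trans m≡q*p (ℕP.*-comm q p)) ⟩
    (p ℕ.* q) Mult.× z     ≈⟨ ×-assocˡ z p q ⟨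
    p Mult.× (q Mult.× z)  ≈⟨ char (q Mult.× z) ⟩
    0#                     ∎

  module _ (x y : Carrier) where

    firstBinomialTerm≈y^n : ∀ n → (n C 0) Mult.× (x ^ 0 * y ^ n) ≈ y ^ n
    firstBinomialTerm≈y^n n = trans (×-homo-1 _) (*-identityˡ _)

    lastBinomialTerm≈x^n : ∀ n → (n C toℕ (fromℕ n)) Mult.× (x ^ toℕ (fromℕ n) * y ^ (n ∸ toℕ (fromℕ n))) ≈ x ^ n
    lastBinomialTerm≈x^n n rewrite toℕ-fromℕ n | nCn≡1 n | ℕP.n∸n≡0 n = trans (×-homo-1 _) (*-identityʳ _)

  frobenius : ∀ {p} → Prime p → (∀ z → p Mult.× z ≈ 0#) → ∀ x y → (x + y) ^ p ≈ x ^ p + y ^ p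
  frobenius {suc m} p-prime char x y = begin
    (x + y) ^ suc m                             ≈⟨ theorem (suc m) x y ⟩
    t zero + sum (λ i → t (suc i))              ≈⟨ +-cong (firstBinomialTerm≈y^n x y (suc m)) (sum-init-last (λ i → t (suc i))) ⟩
    y ^ suc m + (sum (λ i → t (suc (inject₁ i))) + t (suc (fromℕ m)))
      ≈⟨ +-congˡ (+-cong (trans (sum-cong-≋ middleTerm≈0#) (sum-replicate-zero m)) (lastBinomialTerm≈x^n x y (suc m))) ⟩
    y ^ suc m + (0# + x ^ suc m)                ≈⟨ +-congˡ (+-identityˡ _) ⟩
    y ^ suc m + x ^ suc m                       ≈⟨ +-comm _ _ ⟩
    x ^ suc m + y ^ suc m                       ∎
    where
    t = binomialTerm x y (suc m)
    middleTerm≈0# : ∀ i → t (suc (inject₁ i)) ≈ 0#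
    middleTerm≈0# i = ∣⇒×≈0# char (prime∣pCk p-prime (s≤s z≤n) (ℕ.s<s i<m)) _
      where i<m = subst (_< m) (≡.sym (toℕ-inject₁ i)) (toℕ<n i)

  frobenius-[x-1] : ∀ {p} → Prime p → (∀ z → p Mult.× z ≈ 0#) → ∀ x → (x - 1#) ^ p ≈ x ^ p - 1#
  frobenius-[x-1] {suc m} p-prime char x = trans (frobenius p-prime char x (- 1#)) (+-congˡ [-1]^p≈-1)
    where
    [-1]^p≈-1 : (- 1#) ^ suc m ≈ - 1#
    [-1]^p≈-1 = inverseʳ-unique 1# _ (begin
      1# + (- 1#) ^ suc m              ≈⟨ +-congʳ (1#^n≈1# (suc m)) ⟨
      1# ^ suc m + (- 1#) ^ suc m      ≈⟨ frobenius p-prime char 1# (- 1#) ⟨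
      (1# - 1#) ^ suc m                ≈⟨ *-congʳ (-‿inverseʳ 1#) ⟩
      0# * (1# - 1#) ^ m               ≈⟨ zeroˡ _ ⟩
      0#                               ∎)

-- Integer polynomials

open import Data.Integer.Base using (ℤ; +_; -_; _+_; _*_; _-_)
open import Data.Integer.Divisibility using () renaming (_∣_ to _∣ᵤ_)
open import Data.Integer.Divisibility.Signed
  using (_∣_; divides; ∣-refl; ∣m⇒∣-m; ∣m∣n⇒∣m+n; ∣n⇒∣m*n; ∣m⇒∣m*n; ∣⇒∣ᵤ)
open import Data.Integer.Properties as ℤP using ()
open import Data.Integer.Tactic.RingSolver using (solve-∀)

infix 4 _≈_
record _≈_ (f g : Poly) : Set where
  constructor mk≈
  field coeff-≡ : ∀ k → coeff f k ≡ coeff g k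
open _≈_ public

≈-refl : ∀ {f} → f ≈ f
≈-refl = mk≈ λ _ → refl

≈-sym : ∀ {f g} → f ≈ g → g ≈ f
≈-sym f≈g = mk≈ λ k → ≡.sym (coeff-≡ f≈g k)

≈-trans : ∀ {f g h} → f ≈ g → g ≈ h → f ≈ h
≈-trans f≈g g≈h = mk≈ λ k → ≡.trans (coeff-≡ f≈g k) (coeff-≡ g≈h k)

neg : Poly → Poly
neg = map (λ a → - a)

one : Poly
one = + 1 ∷ []

coeff-⊕ : ∀ f g k → coeff (f ⊕ g) k ≡ coeff f k + coeff g k
coeff-⊕ []      g       k       = ≡.sym (ℤP.+-identityˡ _)
coeff-⊕ (a ∷ f) []      k       = ≡.sym (ℤP.+-identityʳ _)
coeff-⊕ (a ∷ f) (b ∷ g) zero    = refl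
coeff-⊕ (a ∷ f) (b ∷ g) (suc k) = coeff-⊕ f g k

coeff-map : ∀ (φ : ℤ → ℤ) → φ (+ 0) ≡ + 0 → ∀ f k → coeff (map φ f) k ≡ φ (coeff f k)
coeff-map φ φ0≡0 []      k       = ≡.sym φ0≡0
coeff-map φ φ0≡0 (a ∷ f) zero    = refl
coeff-map φ φ0≡0 (a ∷ f) (suc k) = coeff-map φ φ0≡0 f k

coeff-neg : ∀ f k → coeff (neg f) k ≡ - coeff f k
coeff-neg = coeff-map (λ a → - a) refl

coeff-∷-⊛ : ∀ a f g k → coeff ((a ∷ f) ⊛ g) k ≡ a * coeff g k + coeff (+ 0 ∷ (f ⊛ g)) k
coeff-∷-⊛ a f g k =
  ≡.trans (coeff-⊕ (map (a *_) g) _ k) (cong (_+ _) (coeff-map (a *_) (ℤP.*-zeroʳ a) g k))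

coeff-⊛-∷ : ∀ f b g k → coeff (f ⊛ (b ∷ g)) k ≡ coeff f k * b + coeff (+ 0 ∷ (f ⊛ g)) k
coeff-⊛-∷ []      b g zero    = refl
coeff-⊛-∷ []      b g (suc k) = refl
coeff-⊛-∷ (a ∷ f) b g zero    = coeff-∷-⊛ a f (b ∷ g) zero
coeff-⊛-∷ (a ∷ f) b g (suc k) = begin
  coeff ((a ∷ f) ⊛ (b ∷ g)) (suc k)
    ≡⟨ coeff-∷-⊛ a f (b ∷ g) (suc k) ⟩
  a * coeff g k + coeff (f ⊛ (b ∷ g)) k
    ≡⟨ cong (_+_ (a * coeff g k)) (coeff-⊛-∷ f b g k) ⟩
  a * coeff g k + (coeff f k * b + coeff (+ 0 ∷ (f ⊛ g)) k)
    ≡⟨ x+[y+z]≡y+[x+z] (a * coeff g k) (coeff f k * b) _ ⟩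
  coeff f k * b + (a * coeff g k + coeff (+ 0 ∷ (f ⊛ g)) k)
    ≡⟨ cong (_+_ (coeff f k * b)) (coeff-∷-⊛ a f g k) ⟨
  coeff f k * b + coeff ((a ∷ f) ⊛ g) k
    ∎
  where
  open ≡-Reasoning
  x+[y+z]≡y+[x+z] : ∀ x y z → x + (y + z) ≡ y + (x + z)
  x+[y+z]≡y+[x+z] = solve-∀

coeff-0∷[] : ∀ k → coeff (+ 0 ∷ []) k ≡ + 0
coeff-0∷[] zero    = refl
coeff-0∷[] (suc k) = refl

∷-cong : ∀ {a f g} → f ≈ g → a ∷ f ≈ a ∷ g
∷-cong f≈g = mk≈ λ { zero → refl ; (suc k) → coeff-≡ f≈g k }

⊕-cong : ∀ {f f′ g g′} → f ≈ f′ → g ≈ g′ → f ⊕ g ≈ f′ ⊕ g′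
⊕-cong {f} {f′} {g} {g′} f≈f′ g≈g′ = mk≈ λ k → begin
  coeff (f ⊕ g) k           ≡⟨ coeff-⊕ f g k ⟩
  coeff f k + coeff g k     ≡⟨ cong₂ _+_ (coeff-≡ f≈f′ k) (coeff-≡ g≈g′ k) ⟩
  coeff f′ k + coeff g′ k   ≡⟨ coeff-⊕ f′ g′ k ⟨
  coeff (f′ ⊕ g′) k         ∎
  where open ≡-Reasoning

⊕-assoc : ∀ f g h → (f ⊕ g) ⊕ h ≈ f ⊕ (g ⊕ h)
⊕-assoc f g h = mk≈ λ k → begin
  coeff ((f ⊕ g) ⊕ h) k                  ≡⟨ ≡.trans (coeff-⊕ (f ⊕ g) h k) (cong (_+ coeff h k) (coeff-⊕ f g k)) ⟩
  coeff f k + coeff g k + coeff h k      ≡⟨ ℤP.+-assoc (coeff f k) _ _ ⟩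
  coeff f k + (coeff g k + coeff h k)    ≡⟨ ≡.trans (coeff-⊕ f (g ⊕ h) k) (cong (_+_ (coeff f k)) (coeff-⊕ g h k)) ⟨
  coeff (f ⊕ (g ⊕ h)) k                  ∎
  where open ≡-Reasoning

⊕-comm : ∀ f g → f ⊕ g ≈ g ⊕ f
⊕-comm f g = mk≈ λ k → ≡.trans (coeff-⊕ f g k) (≡.trans (ℤP.+-comm (coeff f k) _) (≡.sym (coeff-⊕ g f k)))

⊕-identityʳ : ∀ f → f ⊕ [] ≈ f
⊕-identityʳ f = mk≈ λ k → ≡.trans (coeff-⊕ f [] k) (ℤP.+-identityʳ _)

⊕-inverseʳ : ∀ f → f ⊕ neg f ≈ []
⊕-inverseʳ f = mk≈ λ k →
  ≡.trans (coeff-⊕ f (neg f) k) (≡.trans (cong (_+_ (coeff f k)) (coeff-neg f k)) (ℤP.+-inverseʳ (coeff f k)))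

⊕-inverseˡ : ∀ f → neg f ⊕ f ≈ []
⊕-inverseˡ f = ≈-trans (⊕-comm (neg f) f) (⊕-inverseʳ f)

⊛-zeroʳ : ∀ f → f ⊛ [] ≈ []
⊛-zeroʳ []      = ≈-refl
⊛-zeroʳ (a ∷ f) = mk≈ λ { zero → refl ; (suc k) → coeff-≡ (⊛-zeroʳ f) k }

⊛-comm : ∀ f g → f ⊛ g ≈ g ⊛ f
⊛-comm []      g       = ≈-sym (⊛-zeroʳ g)
⊛-comm (a ∷ f) []      = ⊛-zeroʳ (a ∷ f)
⊛-comm (a ∷ f) (b ∷ g) = mk≈ coeff-comm
  where
  open ≡-Reasoning
  rearrange : ∀ a x y b z → a * x + (y * b + z) ≡ b * y + (x * a + z)
  rearrange = solve-∀
  coeff-comm : ∀ k → coeff ((a ∷ f) ⊛ (b ∷ g)) k ≡ coeff ((b ∷ g) ⊛ (a ∷ f)) k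
  coeff-comm zero    = cong (_+ + 0) (ℤP.*-comm a b)
  coeff-comm (suc k) = begin
    coeff ((a ∷ f) ⊛ (b ∷ g)) (suc k)
      ≡⟨ coeff-∷-⊛ a f (b ∷ g) (suc k) ⟩
    a * coeff g k + coeff (f ⊛ (b ∷ g)) k
      ≡⟨ cong (_+_ (a * coeff g k)) (coeff-⊛-∷ f b g k) ⟩
    a * coeff g k + (coeff f k * b + coeff (+ 0 ∷ (f ⊛ g)) k)
      ≡⟨ cong (λ c → a * coeff g k + (coeff f k * b + c)) (coeff-≡ (∷-cong (⊛-comm f g)) k) ⟩
    a * coeff g k + (coeff f k * b + coeff (+ 0 ∷ (g ⊛ f)) k)
      ≡⟨ rearrange a (coeff g k) (coeff f k) b _ ⟩
    b * coeff f k + (coeff g k * a + coeff (+ 0 ∷ (g ⊛ f)) k)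
      ≡⟨ cong (_+_ (b * coeff f k)) (coeff-⊛-∷ g a f k) ⟨
    b * coeff f k + coeff (g ⊛ (a ∷ f)) k
      ≡⟨ coeff-∷-⊛ b g (a ∷ f) (suc k) ⟨
    coeff ((b ∷ g) ⊛ (a ∷ f)) (suc k)
      ∎

⊛-congʳ : ∀ f {g g′} → g ≈ g′ → f ⊛ g ≈ f ⊛ g′
⊛-congʳ []      g≈g′ = ≈-refl
⊛-congʳ (a ∷ f) {g} {g′} g≈g′ = mk≈ λ k → begin
  coeff ((a ∷ f) ⊛ g) k                       ≡⟨ coeff-∷-⊛ a f g k ⟩
  a * coeff g k + coeff (+ 0 ∷ (f ⊛ g)) k
    ≡⟨ cong₂ _+_ (cong (a *_) (coeff-≡ g≈g′ k)) (coeff-≡ (∷-cong (⊛-congʳ f g≈g′)) k) ⟩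
  a * coeff g′ k + coeff (+ 0 ∷ (f ⊛ g′)) k   ≡⟨ coeff-∷-⊛ a f g′ k ⟨
  coeff ((a ∷ f) ⊛ g′) k                      ∎
  where open ≡-Reasoning

⊛-congˡ : ∀ {f f′} g → f ≈ f′ → f ⊛ g ≈ f′ ⊛ g
⊛-congˡ {f} {f′} g f≈f′ = ≈-trans (⊛-comm f g) (≈-trans (⊛-congʳ g f≈f′) (⊛-comm g f′))

⊛-distribʳ : ∀ f g h → (f ⊕ g) ⊛ h ≈ (f ⊛ h) ⊕ (g ⊛ h)
⊛-distribʳ []      g       h = ≈-refl
⊛-distribʳ (a ∷ f) []      h = ≈-sym (⊕-identityʳ _)
⊛-distribʳ (a ∷ f) (b ∷ g) h = mk≈ λ k → begin
  coeff (((a + b) ∷ (f ⊕ g)) ⊛ h) k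
    ≡⟨ coeff-∷-⊛ (a + b) (f ⊕ g) h k ⟩
  (a + b) * coeff h k + coeff (+ 0 ∷ ((f ⊕ g) ⊛ h)) k
    ≡⟨ cong (_+_ ((a + b) * coeff h k)) (coeff-≡ (∷-cong (⊛-distribʳ f g h)) k) ⟩
  (a + b) * coeff h k + coeff ((+ 0 ∷ (f ⊛ h)) ⊕ (+ 0 ∷ (g ⊛ h))) k
    ≡⟨ cong (_+_ ((a + b) * coeff h k)) (coeff-⊕ (+ 0 ∷ (f ⊛ h)) (+ 0 ∷ (g ⊛ h)) k) ⟩
  (a + b) * coeff h k + (coeff (+ 0 ∷ (f ⊛ h)) k + coeff (+ 0 ∷ (g ⊛ h)) k)
    ≡⟨ rearrange a b (coeff h k) _ _ ⟩
  (a * coeff h k + coeff (+ 0 ∷ (f ⊛ h)) k) + (b * coeff h k + coeff (+ 0 ∷ (g ⊛ h)) k)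
    ≡⟨ cong₂ _+_ (coeff-∷-⊛ a f h k) (coeff-∷-⊛ b g h k) ⟨
  coeff ((a ∷ f) ⊛ h) k + coeff ((b ∷ g) ⊛ h) k
    ≡⟨ coeff-⊕ ((a ∷ f) ⊛ h) _ k ⟨
  coeff (((a ∷ f) ⊛ h) ⊕ ((b ∷ g) ⊛ h)) k
    ∎
  where
  open ≡-Reasoning
  rearrange : ∀ a b x y z → (a + b) * x + (y + z) ≡ (a * x + y) + (b * x + z)
  rearrange = solve-∀

⊛-distribˡ : ∀ h f g → h ⊛ (f ⊕ g) ≈ (h ⊛ f) ⊕ (h ⊛ g)
⊛-distribˡ h f g =
  ≈-trans (⊛-comm h (f ⊕ g)) (≈-trans (⊛-distribʳ f g h) (⊕-cong (⊛-comm f h) (⊛-comm g h)))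

0∷-⊛ : ∀ f g → (+ 0 ∷ f) ⊛ g ≈ + 0 ∷ (f ⊛ g)
0∷-⊛ f g = mk≈ λ k → ≡.trans (coeff-∷-⊛ (+ 0) f g k) (ℤP.+-identityˡ _)

map-*-⊛ : ∀ a f g → map (a *_) f ⊛ g ≈ map (a *_) (f ⊛ g)
map-*-⊛ a []      g = ≈-refl
map-*-⊛ a (b ∷ f) g = mk≈ λ k → begin
  coeff ((a * b ∷ map (a *_) f) ⊛ g) k
    ≡⟨ coeff-∷-⊛ (a * b) (map (a *_) f) g k ⟩
  a * b * coeff g k + coeff (+ 0 ∷ (map (a *_) f ⊛ g)) k
    ≡⟨ cong (_+_ (a * b * coeff g k)) (coeff-≡ (≈-trans (∷-cong (map-*-⊛ a f g)) 0∷-map) k) ⟩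
  a * b * coeff g k + coeff (map (a *_) (+ 0 ∷ (f ⊛ g))) k
    ≡⟨ cong (_+_ (a * b * coeff g k)) (coeff-map (a *_) (ℤP.*-zeroʳ a) (+ 0 ∷ (f ⊛ g)) k) ⟩
  a * b * coeff g k + a * coeff (+ 0 ∷ (f ⊛ g)) k
    ≡⟨ factor a b _ _ ⟩
  a * (b * coeff g k + coeff (+ 0 ∷ (f ⊛ g)) k)
    ≡⟨ cong (a *_) (coeff-∷-⊛ b f g k) ⟨
  a * coeff ((b ∷ f) ⊛ g) k
    ≡⟨ coeff-map (a *_) (ℤP.*-zeroʳ a) ((b ∷ f) ⊛ g) k ⟨
  coeff (map (a *_) ((b ∷ f) ⊛ g)) k
    ∎
  where
  open ≡-Reasoning
  0∷-map : + 0 ∷ map (a *_) (f ⊛ g) ≈ map (a *_) (+ 0 ∷ (f ⊛ g))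
  0∷-map = mk≈ λ { zero → ≡.sym (ℤP.*-zeroʳ a) ; (suc k) → refl }
  factor : ∀ a b x y → a * b * x + a * y ≡ a * (b * x + y)
  factor = solve-∀

⊛-assoc : ∀ f g h → (f ⊛ g) ⊛ h ≈ f ⊛ (g ⊛ h)
⊛-assoc []      g h = ≈-refl
⊛-assoc (a ∷ f) g h =
  ≈-trans (⊛-distribʳ (map (a *_) g) (+ 0 ∷ (f ⊛ g)) h)
          (⊕-cong (map-*-⊛ a g h) (≈-trans (0∷-⊛ (f ⊛ g) h) (∷-cong (⊛-assoc f g h))))

⊛-identityˡ : ∀ f → one ⊛ f ≈ f
⊛-identityˡ f = mk≈ λ k → begin
  coeff (one ⊛ f) k                     ≡⟨ coeff-∷-⊛ (+ 1) [] f k ⟩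
  + 1 * coeff f k + coeff (+ 0 ∷ []) k  ≡⟨ cong₂ _+_ (ℤP.*-identityˡ (coeff f k)) (coeff-0∷[] k) ⟩
  coeff f k + + 0                       ≡⟨ ℤP.+-identityʳ _ ⟩
  coeff f k                             ∎
  where open ≡-Reasoning

⊛-identityʳ : ∀ f → f ⊛ one ≈ f
⊛-identityʳ f = ≈-trans (⊛-comm f one) (⊛-identityˡ f)

module Modulo (p : ℕ) where

  infix 4 _≡ₚ_ _≈ₚ_

  record _≡ₚ_ (a b : ℤ) : Set where
    constructor mk≡ₚ
    field p∣a-b : + p ∣ a - b
  open _≡ₚ_ public

  ≡⇒≡ₚ : ∀ {a b} → a ≡ b → a ≡ₚ b
  ≡⇒≡ₚ {a} refl = mk≡ₚ (divides (+ 0) (≡.trans (ℤP.+-inverseʳ a) (≡.sym (ℤP.*-zeroˡ (+ p)))))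

  ≡ₚ-sym : ∀ {a b} → a ≡ₚ b → b ≡ₚ a
  ≡ₚ-sym {a} {b} (mk≡ₚ a≡b) = mk≡ₚ (subst (+ p ∣_) (-[a-b]≡b-a a b) (∣m⇒∣-m a≡b))
    where
    -[a-b]≡b-a : ∀ a b → - (a - b) ≡ b - a
    -[a-b]≡b-a = solve-∀

  ≡ₚ-trans : ∀ {a b c} → a ≡ₚ b → b ≡ₚ c → a ≡ₚ c
  ≡ₚ-trans {a} {b} {c} (mk≡ₚ a≡b) (mk≡ₚ b≡c) =
    mk≡ₚ (subst (+ p ∣_) ([a-b]+[b-c]≡a-c a b c) (∣m∣n⇒∣m+n a≡b b≡c))
    where
    [a-b]+[b-c]≡a-c : ∀ a b c → (a - b) + (b - c) ≡ a - c
    [a-b]+[b-c]≡a-c = solve-∀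

  +-congₚ : ∀ {a a′ b b′} → a ≡ₚ a′ → b ≡ₚ b′ → a + b ≡ₚ a′ + b′
  +-congₚ {a} {a′} {b} {b′} (mk≡ₚ a≡a′) (mk≡ₚ b≡b′) =
    mk≡ₚ (subst (+ p ∣_) (≡.sym (regroup a b a′ b′)) (∣m∣n⇒∣m+n a≡a′ b≡b′))
    where
    regroup : ∀ a b a′ b′ → (a + b) - (a′ + b′) ≡ (a - a′) + (b - b′)
    regroup = solve-∀

  -‿congₚ : ∀ {a b} → a ≡ₚ b → - a ≡ₚ - b
  -‿congₚ {a} {b} (mk≡ₚ a≡b) = mk≡ₚ (subst (+ p ∣_) (≡.sym ([-a]-[-b]≡-[a-b] a b)) (∣m⇒∣-m a≡b))
    where
    [-a]-[-b]≡-[a-b] : ∀ a b → - a - - b ≡ - (a - b)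
    [-a]-[-b]≡-[a-b] = solve-∀

  *-congˡₚ : ∀ c {a b} → a ≡ₚ b → c * a ≡ₚ c * b
  *-congˡₚ c {a} {b} (mk≡ₚ a≡b) = mk≡ₚ (subst (+ p ∣_) (≡.sym (ca-cb≡c[a-b] c a b)) (∣n⇒∣m*n c a≡b))
    where
    ca-cb≡c[a-b] : ∀ c a b → c * a - c * b ≡ c * (a - b)
    ca-cb≡c[a-b] = solve-∀

  record _≈ₚ_ (f g : Poly) : Set where
    constructor mk≈ₚ
    field coeff-≡ₚ : ∀ k → coeff f k ≡ₚ coeff g k
  open _≈ₚ_ public

  ≈⇒≈ₚ : ∀ {f g} → f ≈ g → f ≈ₚ g
  ≈⇒≈ₚ f≈g = mk≈ₚ λ k → ≡⇒≡ₚ (coeff-≡ f≈g k)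

  ≈ₚ-refl : ∀ {f} → f ≈ₚ f
  ≈ₚ-refl = ≈⇒≈ₚ ≈-refl

  ≈ₚ-sym : ∀ {f g} → f ≈ₚ g → g ≈ₚ f
  ≈ₚ-sym f≈g = mk≈ₚ λ k → ≡ₚ-sym (coeff-≡ₚ f≈g k)

  ≈ₚ-trans : ∀ {f g h} → f ≈ₚ g → g ≈ₚ h → f ≈ₚ h
  ≈ₚ-trans f≈g g≈h = mk≈ₚ λ k → ≡ₚ-trans (coeff-≡ₚ f≈g k) (coeff-≡ₚ g≈h k)

  ∷-congₚ : ∀ {a f g} → f ≈ₚ g → a ∷ f ≈ₚ a ∷ g
  ∷-congₚ f≈g = mk≈ₚ λ { zero → ≡⇒≡ₚ refl ; (suc k) → coeff-≡ₚ f≈g k }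

  ⊕-congₚ : ∀ {f f′ g g′} → f ≈ₚ f′ → g ≈ₚ g′ → f ⊕ g ≈ₚ f′ ⊕ g′
  ⊕-congₚ {f} {f′} {g} {g′} f≈f′ g≈g′ = mk≈ₚ λ k →
    subst₂ _≡ₚ_ (≡.sym (coeff-⊕ f g k)) (≡.sym (coeff-⊕ f′ g′ k))
      (+-congₚ (coeff-≡ₚ f≈f′ k) (coeff-≡ₚ g≈g′ k))

  neg-congₚ : ∀ {f g} → f ≈ₚ g → neg f ≈ₚ neg g
  neg-congₚ {f} {g} f≈g = mk≈ₚ λ k →
    subst₂ _≡ₚ_ (≡.sym (coeff-neg f k)) (≡.sym (coeff-neg g k)) (-‿congₚ (coeff-≡ₚ f≈g k))

  ⊛-congʳₚ : ∀ f {g g′} → g ≈ₚ g′ → f ⊛ g ≈ₚ f ⊛ g′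
  ⊛-congʳₚ []      g≈g′ = ≈ₚ-refl
  ⊛-congʳₚ (a ∷ f) {g} {g′} g≈g′ = mk≈ₚ λ k →
    subst₂ _≡ₚ_ (≡.sym (coeff-∷-⊛ a f g k)) (≡.sym (coeff-∷-⊛ a f g′ k))
      (+-congₚ (*-congˡₚ a (coeff-≡ₚ g≈g′ k)) (coeff-≡ₚ (∷-congₚ (⊛-congʳₚ f g≈g′)) k))

  ⊛-congₚ : ∀ {f f′ g g′} → f ≈ₚ f′ → g ≈ₚ g′ → f ⊛ g ≈ₚ f′ ⊛ g′
  ⊛-congₚ {f} {f′} {g} {g′} f≈f′ g≈g′ =
    ≈ₚ-trans (⊛-congʳₚ f g≈g′)
      (≈ₚ-trans (≈⇒≈ₚ (⊛-comm f g′)) (≈ₚ-trans (⊛-congʳₚ g′ f≈f′) (≈⇒≈ₚ (⊛-comm g′ f′))))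

  isCommutativeRing : IsCommutativeRing _≈ₚ_ _⊕_ _⊛_ neg [] one
  isCommutativeRing = record
    { isRing = record
      { +-isAbelianGroup = record
        { isGroup = record
          { isMonoid = record
            { isSemigroup = record
              { isMagma = record
                { isEquivalence = record { refl = ≈ₚ-refl ; sym = ≈ₚ-sym ; trans = ≈ₚ-trans }
                ; ∙-cong = ⊕-congₚ }
              ; assoc = λ f g h → ≈⇒≈ₚ (⊕-assoc f g h) }
            ; identity = (λ _ → ≈ₚ-refl) , (λ f → ≈⇒≈ₚ (⊕-identityʳ f)) }
          ; inverse = (λ f → ≈⇒≈ₚ (⊕-inverseˡ f)) , (λ f → ≈⇒≈ₚ (⊕-inverseʳ f))
          ; ⁻¹-cong = neg-congₚ }
        ; comm = λ f g → ≈⇒≈ₚ (⊕-comm f g) }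
      ; *-cong = ⊛-congₚ
      ; *-assoc = λ f g h → ≈⇒≈ₚ (⊛-assoc f g h)
      ; *-identity = (λ f → ≈⇒≈ₚ (⊛-identityˡ f)) , (λ f → ≈⇒≈ₚ (⊛-identityʳ f))
      ; distrib = (λ f g h → ≈⇒≈ₚ (⊛-distribˡ f g h)) , (λ f g h → ≈⇒≈ₚ (⊛-distribʳ g h f)) }
    ; *-comm = λ f g → ≈⇒≈ₚ (⊛-comm f g) }

  ℤₚ[x] : CommutativeRing 0ℓ 0ℓ
  ℤₚ[x] = record { isCommutativeRing = isCommutativeRing }

  open CommutativeRing ℤₚ[x] using (+-monoid)
  import Algebra.Properties.Monoid.Mult +-monoid as Mult

  coeff-× : ∀ n f k → coeff (n Mult.× f) k ≡ + n * coeff f k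
  coeff-× zero    f k = ≡.sym (ℤP.*-zeroˡ (coeff f k))
  coeff-× (suc n) f k = begin
    coeff (f ⊕ (n Mult.× f)) k         ≡⟨ coeff-⊕ f (n Mult.× f) k ⟩
    coeff f k + coeff (n Mult.× f) k   ≡⟨ cong (_+_ (coeff f k)) (coeff-× n f k) ⟩
    coeff f k + + n * coeff f k        ≡⟨ ℤP.suc-* (+ n) (coeff f k) ⟨
    + suc n * coeff f k                ∎
    where open ≡-Reasoning

  p×f≈ₚ0 : ∀ f → p Mult.× f ≈ₚ []
  p×f≈ₚ0 f = mk≈ₚ λ k →
    mk≡ₚ (subst (+ p ∣_) (≡.sym (≡.trans (ℤP.+-identityʳ _) (coeff-× p f k))) (∣m⇒∣m*n (coeff f k) ∣-refl))

-- Degrees and monic polynomials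

x : Poly
x = + 0 ∷ + 1 ∷ []

Deg≤ : ℕ → Poly → Set
Deg≤ d f = ∀ k → d < k → coeff f k ≡ + 0

record Monic (d : ℕ) (f : Poly) : Set where
  constructor monic
  field
    leading : coeff f d ≡ + 1
    deg≤    : Deg≤ d f
open Monic public

Monic-cong : ∀ {d f g} → f ≈ g → Monic d f → Monic d g
Monic-cong f≈g (monic f-leading f≤d) =
  monic (≡.trans (≡.sym (coeff-≡ f≈g _)) f-leading) (λ k d<k → ≡.trans (≡.sym (coeff-≡ f≈g k)) (f≤d k d<k))

Monic-one : Monic 0 one
Monic-one = monic refl λ { (suc k) _ → refl }

Monic-x : Monic 1 x
Monic-x = monic refl λ { (suc zero) (s≤s ()) ; (suc (suc k)) _ → refl }

Monic-⊕-lower : ∀ {d e f g} → Monic d f → Deg≤ e g → e < d → Monic d (f ⊕ g)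
Monic-⊕-lower {d} {e} {f} {g} (monic f-leading f≤d) g≤e e<d = monic
  (≡.trans (coeff-⊕ f g d) (cong₂ _+_ f-leading (g≤e d e<d)))
  (λ k d<k → ≡.trans (coeff-⊕ f g k) (cong₂ _+_ (f≤d k d<k) (g≤e k (ℕP.<-trans e<d d<k))))

Deg≤-neg-one : Deg≤ 0 (neg one)
Deg≤-neg-one (suc k) _ = refl

private
  Deg≤-tail : ∀ {a c f} → Deg≤ (suc a) (c ∷ f) → Deg≤ a f
  Deg≤-tail f≤1+a k a<k = f≤1+a (suc k) (s≤s a<k)

  constant-⊛ : ∀ {c f} g → Deg≤ 0 (c ∷ f) → ∀ k → coeff ((c ∷ f) ⊛ g) k ≡ c * coeff g k
  constant-⊛ {c} {f} g f≤0 k = begin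
    coeff ((c ∷ f) ⊛ g) k                     ≡⟨ coeff-∷-⊛ c f g k ⟩
    c * coeff g k + coeff (+ 0 ∷ (f ⊛ g)) k   ≡⟨ cong (_+_ (c * coeff g k)) (coeff-≡ (∷-cong (⊛-congˡ g f≈[])) k) ⟩
    c * coeff g k + coeff (+ 0 ∷ []) k        ≡⟨ cong (_+_ (c * coeff g k)) (coeff-0∷[] k) ⟩
    c * coeff g k + + 0                       ≡⟨ ℤP.+-identityʳ _ ⟩
    c * coeff g k                             ∎
    where
    open ≡-Reasoning
    f≈[] : f ≈ []
    f≈[] = mk≈ λ k → f≤0 (suc k) (s≤s z≤n)

Deg≤-⊛ : ∀ a {b} f g → Deg≤ a f → Deg≤ b g → Deg≤ (a ℕ.+ b) (f ⊛ g)
Deg≤-⊛ a       []      g f≤a g≤b k _ = refl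
Deg≤-⊛ zero    (c ∷ f) g f≤0 g≤b k b<k =
  ≡.trans (constant-⊛ g f≤0 k) (≡.trans (cong (c *_) (g≤b k b<k)) (ℤP.*-zeroʳ c))
Deg≤-⊛ (suc a) {b} (c ∷ f) g f≤1+a g≤b (suc k) (s≤s a+b<k) = begin
  coeff ((c ∷ f) ⊛ g) (suc k)             ≡⟨ coeff-∷-⊛ c f g (suc k) ⟩
  c * coeff g (suc k) + coeff (f ⊛ g) k
    ≡⟨ cong₂ _+_ (cong (c *_) (g≤b (suc k) b<1+k)) (Deg≤-⊛ a f g (Deg≤-tail f≤1+a) g≤b k a+b<k) ⟩
  c * + 0 + + 0                           ≡⟨ cong (_+ + 0) (ℤP.*-zeroʳ c) ⟩
  + 0                                     ∎
  where
  open ≡-Reasoning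
  b<1+k = ℕP.m≤n⇒m≤1+n (ℕP.≤-<-trans (ℕP.m≤n+m b a) a+b<k)

coeff-⊛-leading : ∀ a {b} f g → Deg≤ a f → Deg≤ b g → coeff (f ⊛ g) (a ℕ.+ b) ≡ coeff f a * coeff g b
coeff-⊛-leading a       {b} []      g f≤a g≤b = ≡.sym (ℤP.*-zeroˡ (coeff g b))
coeff-⊛-leading zero    {b} (c ∷ f) g f≤0 g≤b = constant-⊛ g f≤0 b
coeff-⊛-leading (suc a) {b} (c ∷ f) g f≤1+a g≤b = begin
  coeff ((c ∷ f) ⊛ g) (suc (a ℕ.+ b))
    ≡⟨ coeff-∷-⊛ c f g (suc (a ℕ.+ b)) ⟩
  c * coeff g (suc (a ℕ.+ b)) + coeff (f ⊛ g) (a ℕ.+ b)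
    ≡⟨ cong₂ _+_ (cong (c *_) (g≤b _ (s≤s (ℕP.m≤n+m b a)))) (coeff-⊛-leading a f g (Deg≤-tail f≤1+a) g≤b) ⟩
  c * + 0 + coeff f a * coeff g b
    ≡⟨ cong (_+ coeff f a * coeff g b) (ℤP.*-zeroʳ c) ⟩
  + 0 + coeff f a * coeff g b
    ≡⟨ ℤP.+-identityˡ _ ⟩
  coeff f a * coeff g b
    ∎
  where open ≡-Reasoning

Monic-⊛ : ∀ {a b f g} → Monic a f → Monic b g → Monic (a ℕ.+ b) (f ⊛ g)
Monic-⊛ {a} {f = f} {g} (monic f-leading f≤a) (monic g-leading g≤b) = monic
  (≡.trans (coeff-⊛-leading a f g f≤a g≤b) (cong₂ _*_ f-leading g-leading))
  (Deg≤-⊛ a f g f≤a g≤b)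

x⊛f≈0∷f : ∀ f → x ⊛ f ≈ + 0 ∷ f
x⊛f≈0∷f f = ≈-trans (0∷-⊛ one f) (∷-cong (⊛-identityˡ f))

truncation : (d : ℕ) → (ℕ → ℤ) → Vec ℤ (suc d)
truncation zero    c = c 0 ∷ []
truncation (suc d) c = c 0 ∷ truncation d (c ∘ suc)

last-truncation : ∀ d c → last (truncation d c) ≡ c d
last-truncation zero    c = refl
last-truncation (suc d) c = ≡.trans (last-∷ (c 0) (truncation d (c ∘ suc))) (last-truncation d (c ∘ suc))
  where
  last-∷ : ∀ {n} y (v : Vec ℤ (suc n)) → last (y ∷ v) ≡ last v
  last-∷ y (z ∷ v) = refl

coeff-toList-truncation : ∀ d c → (∀ k → d < k → c k ≡ + 0) → ∀ k → coeff (toList (truncation d c)) k ≡ c k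
coeff-toList-truncation zero    c c≤0 zero    = refl
coeff-toList-truncation zero    c c≤0 (suc k) = ≡.sym (c≤0 (suc k) (s≤s z≤n))
coeff-toList-truncation (suc d) c c≤d zero    = refl
coeff-toList-truncation (suc d) c c≤d (suc k) =
  coeff-toList-truncation d (c ∘ suc) (λ k d<k → c≤d (suc k) (s≤s d<k)) k

split : ∀ M {s c d} → c ≤ suc s → d ≤ s ℕ.+ M ℕ.* c →
        ∃₂ λ j r → j ≤ M × r ≤ s × d ≡ r ℕ.+ j ℕ.* c
split zero    {s} {d = d} _ d≤s+0 = 0 , d , z≤n , subst (d ≤_) (ℕP.+-identityʳ s) d≤s+0 , ≡.sym (ℕP.+-identityʳ d)
split (suc M) {s} {c} {d} c≤1+s d≤s+c+Mc with d ℕP.≤? s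
... | yes d≤s = 0 , d , z≤n , d≤s , ≡.sym (ℕP.+-identityʳ d)
... | no  d≰s with split M c≤1+s (ℕP.m≤n+o⇒m∸n≤o d c (subst (d ≤_) (ℕ+.x∙yz≈y∙xz s c (M ℕ.* c)) d≤s+c+Mc))
...   | j , r , j≤M , r≤s , d∸c≡r+jc = suc j , r , s≤s j≤M , r≤s , (begin
  d                       ≡⟨ ℕP.m+[n∸m]≡n c≤d ⟨
  c ℕ.+ (d ∸ c)           ≡⟨ ≡.cong (c ℕ.+_) d∸c≡r+jc ⟩
  c ℕ.+ (r ℕ.+ j ℕ.* c)   ≡⟨ ℕ+.x∙yz≈y∙xz c r (j ℕ.* c) ⟩
  r ℕ.+ (c ℕ.+ j ℕ.* c)   ∎)
  where
  open ≡-Reasoning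
  c≤d : c ≤ d
  c≤d = ℕP.≤-trans c≤1+s (ℕP.≰⇒> d≰s)

-- Smooth numbers

data Smooth (B : ℕ) : ℕ → Set where
  smooth-one : Smooth B 1
  smooth-*   : ∀ {l m} → 2 ≤ l → l ≤ B → Smooth B m → Smooth B (l ℕ.* m)

Smooth⇒0< : ∀ {B m} → Smooth B m → 0 < m
Smooth⇒0< smooth-one                          = s≤s z≤n
Smooth⇒0< (smooth-* {l} (s≤s _) _ m-smooth) = ℕP.*-mono-< {0} {l} (s≤s z≤n) (Smooth⇒0< m-smooth)

Smooth-mono : ∀ {B B′ m} → B ≤ B′ → Smooth B m → Smooth B′ m
Smooth-mono B≤B′ smooth-one                  = smooth-one
Smooth-mono B≤B′ (smooth-* 2≤l l≤B m-smooth) = smooth-* 2≤l (ℕP.≤-trans l≤B B≤B′) (Smooth-mono B≤B′ m-smooth)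

prime⇒2≤ : ∀ {p} → Prime p → 2 ≤ p
prime⇒2≤ {p} p-prime = ℕ.nonTrivial⇒n>1 p {{prime⇒nonTrivial p-prime}}

largestPrimeFactor : ∀ {q xs} → Prime q → All Prime xs →
                     ∃₂ λ p m → Prime p × q ℕ.* product xs ≡ m ℕ.* p × Smooth p m
largestPrimeFactor {q} q-prime [] = q , 1 , q-prime , ℕP.*-comm q 1 , smooth-one
largestPrimeFactor {q} {y ∷ ys} q-prime (y-prime ∷ ys-prime)
  with largestPrimeFactor y-prime ys-prime
... | p , m , p-prime , y*ys≡m*p , m-smooth with q ℕP.≤? p
...   | yes q≤p = p , q ℕ.* m , p-prime , q*m*p , smooth-* (prime⇒2≤ q-prime) q≤p m-smooth
  where
  q*m*p : q ℕ.* product (y ∷ ys) ≡ q ℕ.* m ℕ.* p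
  q*m*p = ≡.trans (cong (q ℕ.*_) y*ys≡m*p) (≡.sym (ℕP.*-assoc q m p))
...   | no  q≰p = q , p ℕ.* m , q-prime , p*m*q , smooth-* (prime⇒2≤ p-prime) p≤q (Smooth-mono p≤q m-smooth)
  where
  p≤q = ℕP.<⇒≤ (ℕP.≰⇒> q≰p)
  p*m*q : q ℕ.* product (y ∷ ys) ≡ p ℕ.* m ℕ.* q
  p*m*q = ≡.trans (cong (q ℕ.*_) y*ys≡m*p) (rearrange q m p)
    where
    rearrange : ∀ q m p → q ℕ.* (m ℕ.* p) ≡ p ℕ.* m ℕ.* q
    rearrange = ℕSolver.solve-∀

∃-prime-smooth-cofactor : ∀ n → 2 ≤ n → ∃₂ λ p m → Prime p × n ≡ m ℕ.* p × Smooth p m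
∃-prime-smooth-cofactor (suc zero) (s≤s ())
∃-prime-smooth-cofactor n@(suc (suc _)) _ with factorise n
... | record { factors = [] ; isFactorisation = () }
... | record { factors = q ∷ xs ; isFactorisation = n≡q*xs ; factorsPrime = q-prime ∷ xs-prime }
  with largestPrimeFactor q-prime xs-prime
... | p , m , p-prime , q*xs≡m*p , m-smooth = p , m , p-prime , ≡.trans n≡q*xs q*xs≡m*p , m-smooth

module Divisors (p : ℕ) where

  open Modulo p
  open CommutativeRing ℤₚ[x] using (+-congʳ)
  open CommutativeRingProperties ℤₚ[x] using (geometricSum; [y-1]*geometricSum≈y^[1+k]-1)
  open import Algebra.Properties.CommutativeSemiring.Exp (CommutativeRing.commutativeSemiring ℤₚ[x])
    using (_^_; ^-homo-*; ^-congˡ; ^-assocʳ; ^-distrib-*)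

  [x^_-1] : ℕ → Poly
  [x^ n -1] = (x ^ n) ⊕ neg one

  coeff-x^n-1 : ∀ n k → coeff [x^ n -1] k ≡ xⁿ-1 n k
  coeff-x^n-1 n k =
    ≡.trans (coeff-⊕ (x ^ n) (neg one) k) (≡.trans (cong (_+_ (coeff (x ^ n) k)) (coeff-neg one k)) (go n k))
    where
    -- The auxiliary functions of Defs.xⁿ-1 are local, so its cases are matched one by one.
    go : ∀ n k → coeff (x ^ n) k - coeff one k ≡ xⁿ-1 n k
    go zero          zero          = refl
    go zero          (suc k)       = refl
    go (suc n)       zero          rewrite coeff-≡ (x⊛f≈0∷f (x ^ n)) 0 = refl
    go (suc zero)    (suc zero)    rewrite coeff-≡ (x⊛f≈0∷f one) 1 = refl
    go (suc (suc n)) (suc zero)    rewrite coeff-≡ (x⊛f≈0∷f (x ^ suc n)) 1 | coeff-≡ (x⊛f≈0∷f (x ^ n)) 0 = refl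
    go (suc n)       (suc (suc k)) rewrite coeff-≡ (x⊛f≈0∷f (x ^ n)) (suc (suc k)) = go n (suc k)

  Monic-^ : ∀ {e f} M → Monic e f → Monic (e ℕ.* M) (f ^ M)
  Monic-^ {e}     zero    _       = subst (λ d → Monic d one) (≡.sym (ℕP.*-zeroʳ e)) Monic-one
  Monic-^ {e} {f} (suc M) f-monic =
    subst (λ d → Monic d (f ^ suc M)) (≡.sym (ℕP.*-suc e M)) (Monic-⊛ f-monic (Monic-^ M f-monic))

  Monic-x^n : ∀ n → Monic n (x ^ n)
  Monic-x^n n = subst (λ d → Monic d (x ^ n)) (ℕP.*-identityˡ n) (Monic-^ n Monic-x)

  Monic-x^n-1 : ∀ {n} → 0 < n → Monic n [x^ n -1]
  Monic-x^n-1 {n} 0<n = Monic-⊕-lower (Monic-x^n n) Deg≤-neg-one 0<n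

  Monic-geometricSum : ∀ {e y} k → 0 < e → Monic e y → Monic (e ℕ.* k) (geometricSum y k)
  Monic-geometricSum {e}     zero    _   _       = subst (λ d → Monic d one) (≡.sym (ℕP.*-zeroʳ e)) Monic-one
  Monic-geometricSum {e} {y} (suc k) 0<e y-monic =
    subst (λ d → Monic d (geometricSum y (suc k))) (≡.sym (ℕP.*-suc e k))
      (Monic-cong (⊕-comm (y ⊛ geometricSum y k) one)
        (Monic-⊕-lower (Monic-⊛ y-monic (Monic-geometricSum k 0<e y-monic)) (deg≤ Monic-one)
          (ℕP.<-≤-trans 0<e (ℕP.m≤m+n e _))))

  record MonicDivisor (d : ℕ) (f : Poly) : Set where
    field
      divisor cofactor : Poly
      divisor-monic    : Monic d divisor
      factorisation    : divisor ⊛ cofactor ≈ₚ f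

  MonicDivisorsUpTo : ℕ → Poly → Set
  MonicDivisorsUpTo N f = ∀ {d} → d ≤ N → MonicDivisor d f

  MonicDivisorsUpTo-resp : ∀ {N f f′} → f ≈ₚ f′ → MonicDivisorsUpTo N f → MonicDivisorsUpTo N f′
  MonicDivisorsUpTo-resp f≈f′ divisors d≤N = record
    { MonicDivisor (divisors d≤N) ; factorisation = ≈ₚ-trans (MonicDivisor.factorisation (divisors d≤N)) f≈f′ }

  monicDivisorsUpTo-one : MonicDivisorsUpTo 0 one
  monicDivisorsUpTo-one z≤n = record
    { divisor = one ; cofactor = one ; divisor-monic = Monic-one ; factorisation = ≈⇒≈ₚ (⊛-identityˡ one) }

  monicDivisorsUpTo-⊛-^ : ∀ M {s c f G} → MonicDivisorsUpTo s f → Monic c G → c ≤ suc s →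
                          MonicDivisorsUpTo (s ℕ.+ M ℕ.* c) (f ⊛ (G ^ M))
  monicDivisorsUpTo-⊛-^ M {s} {c} {f} {G} divisors G-monic c≤1+s {d} d≤s+Mc
    with split M c≤1+s d≤s+Mc
  ... | j , r , j≤M , r≤s , d≡r+jc = record
    { divisor       = g ⊛ (G ^ j)
    ; cofactor      = h ⊛ (G ^ (M ∸ j))
    ; divisor-monic = subst (λ e → Monic e (g ⊛ (G ^ j))) (≡.trans (≡.cong (r ℕ.+_) (ℕP.*-comm c j)) (≡.sym d≡r+jc))
                        (Monic-⊛ g-monic (Monic-^ j G-monic))
    ; factorisation = begin
        (g ⊛ (G ^ j)) ⊛ (h ⊛ (G ^ (M ∸ j)))   ≈⟨ interchange g (G ^ j) h (G ^ (M ∸ j)) ⟩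
        (g ⊛ h) ⊛ ((G ^ j) ⊛ (G ^ (M ∸ j)))   ≈⟨ ⊛-congₚ gh≈f (≈ₚ-sym (^-homo-* G j (M ∸ j))) ⟩
        f ⊛ (G ^ (j ℕ.+ (M ∸ j)))             ≡⟨ ≡.cong (λ e → f ⊛ (G ^ e)) (ℕP.m+[n∸m]≡n j≤M) ⟩
        f ⊛ (G ^ M)                           ∎
    }
    where
    open MonicDivisor (divisors r≤s) renaming (divisor to g; cofactor to h; divisor-monic to g-monic; factorisation to gh≈f)
    open import Algebra.Properties.CommutativeSemigroup (CommutativeRing.*-commutativeSemigroup ℤₚ[x]) using (interchange)
    open import Relation.Binary.Reasoning.Setoid (CommutativeRing.setoid ℤₚ[x])

  monicDivisorsUpTo-smooth : ∀ M {m} → Smooth M m → MonicDivisorsUpTo (m ℕ.* M) ([x^ m -1] ^ M)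
  monicDivisorsUpTo-smooth M smooth-one =
    MonicDivisorsUpTo-resp (≈⇒≈ₚ (⊛-identityˡ _))
      (subst (λ N → MonicDivisorsUpTo N (one ⊛ ([x^ 1 -1] ^ M))) (≡.trans (ℕP.*-identityʳ M) (≡.sym (ℕP.+-identityʳ M)))
        (monicDivisorsUpTo-⊛-^ M monicDivisorsUpTo-one (Monic-x^n-1 (s≤s z≤n)) (s≤s z≤n)))
  monicDivisorsUpTo-smooth M (smooth-* {suc k} {a} (s≤s 1≤k) 1+k≤M a-smooth) =
    MonicDivisorsUpTo-resp [x^a-1]^M*G^M≈[x^[1+k]a-1]^M
      (subst (λ N → MonicDivisorsUpTo N (([x^ a -1] ^ M) ⊛ (G ^ M))) (degree a k M)
        (monicDivisorsUpTo-⊛-^ M (monicDivisorsUpTo-smooth M a-smooth) G-monic ak≤1+aM))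
    where
    G = geometricSum (x ^ a) k
    G-monic : Monic (a ℕ.* k) G
    G-monic = Monic-geometricSum k (Smooth⇒0< a-smooth) (Monic-x^n a)
    ak≤1+aM : a ℕ.* k ≤ suc (a ℕ.* M)
    ak≤1+aM = ℕP.m≤n⇒m≤1+n (ℕP.*-monoʳ-≤ a (ℕP.≤-trans (ℕP.n≤1+n k) 1+k≤M))
    degree : ∀ a k M → a ℕ.* M ℕ.+ M ℕ.* (a ℕ.* k) ≡ suc k ℕ.* a ℕ.* M
    degree = ℕSolver.solve-∀
    [x^a-1]^M*G^M≈[x^[1+k]a-1]^M : ([x^ a -1] ^ M) ⊛ (G ^ M) ≈ₚ [x^ (suc k ℕ.* a) -1] ^ M
    [x^a-1]^M*G^M≈[x^[1+k]a-1]^M = begin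
      ([x^ a -1] ^ M) ⊛ (G ^ M)          ≈⟨ ^-distrib-* [x^ a -1] G M ⟨
      ([x^ a -1] ⊛ G) ^ M                ≈⟨ ^-congˡ M ([y-1]*geometricSum≈y^[1+k]-1 (x ^ a) k) ⟩
      (((x ^ a) ^ suc k) ⊕ neg one) ^ M  ≈⟨ ^-congˡ M (+-congʳ (^-assocʳ x a (suc k))) ⟩
      [x^ (a ℕ.* suc k) -1] ^ M          ≡⟨ ≡.cong (λ e → [x^ e -1] ^ M) (ℕP.*-comm a (suc k)) ⟩
      [x^ (suc k ℕ.* a) -1] ^ M          ∎
      where open import Relation.Binary.Reasoning.Setoid (CommutativeRing.setoid ℤₚ[x])

module _ {p} (p-prime : Prime p) where

  open Modulo p
  open Divisors p
  open CommutativeRingProperties ℤₚ[x] using (frobenius-[x-1])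
  open import Algebra.Properties.Semiring.Exp (CommutativeRing.semiring ℤₚ[x]) using (_^_; ^-assocʳ)

  monicDivisor⇒hasDivisorOfDegree : ∀ {n d} → MonicDivisor d [x^ n -1] → HasDivisorOfDegree p n d
  monicDivisor⇒hasDivisorOfDegree {n} {d} g∣x^n-1 = v , p∤last , h , p∣vh-[x^n-1]
    where
    open MonicDivisor g∣x^n-1 renaming (divisor to g; cofactor to h; divisor-monic to g-monic; factorisation to gh≈x^n-1)
    v = truncation d (coeff g)
    last≡1 : last v ≡ + 1
    last≡1 = ≡.trans (last-truncation d (coeff g)) (leading g-monic)
    p∤last : ¬ (+ p ∣ᵤ last v)
    p∤last p∣last = ¬prime[1] (subst Prime (ℕ∣.∣1⇒≡1 (subst (+ p ∣ᵤ_) last≡1 p∣last)) p-prime)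
    v≈g : toList v ≈ g
    v≈g = mk≈ (coeff-toList-truncation d (coeff g) (deg≤ g-monic))
    vh≈x^n-1 : toList v ⊛ h ≈ₚ [x^ n -1]
    vh≈x^n-1 = ≈ₚ-trans (≈⇒≈ₚ (⊛-congˡ h v≈g)) gh≈x^n-1
    p∣vh-[x^n-1] : ∀ k → + p ∣ᵤ coeff (toList v ⊛ h) k - xⁿ-1 n k
    p∣vh-[x^n-1] k =
      subst (λ c → + p ∣ᵤ coeff (toList v ⊛ h) k - c) (coeff-x^n-1 n k) (∣⇒∣ᵤ (p∣a-b (coeff-≡ₚ vh≈x^n-1 k)))

  [x^m-1]^p≈x^[m*p]-1 : ∀ m → [x^ m -1] ^ p ≈ₚ [x^ (m ℕ.* p) -1]
  [x^m-1]^p≈x^[m*p]-1 m = ≈ₚ-trans (frobenius-[x-1] p-prime p×f≈ₚ0 (x ^ m)) (⊕-congₚ (^-assocʳ x m p) ≈ₚ-refl)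

  smooth⇒pPractical : ∀ {m} M → Smooth M m → [x^ m -1] ^ M ≈ₚ [x^ (m ℕ.* M) -1] → PPractical p (m ℕ.* M)
  smooth⇒pPractical {m} M m-smooth [x^m-1]^M≈x^[mM]-1 d _ d≤mM =
    monicDivisor⇒hasDivisorOfDegree {m ℕ.* M}
      (MonicDivisorsUpTo-resp [x^m-1]^M≈x^[mM]-1 (monicDivisorsUpTo-smooth M m-smooth) d≤mM)

proposition3p2 : ∀ (n : ℕ) → 1 ≤ n → Σ ℕ λ p → Prime p × PPractical p n
proposition3p2 (suc zero) _ = 2 , prime[2] , smooth⇒pPractical prime[2] 1 smooth-one (Modulo.≈⇒≈ₚ 2 (⊛-identityʳ _))
proposition3p2 n@(suc (suc _)) _ with ∃-prime-smooth-cofactor n (s≤s (s≤s z≤n))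
... | p , m , p-prime , n≡m*p , m-smooth =
  p , p-prime , subst (PPractical p) (≡.sym n≡m*p) (smooth⇒pPractical p-prime p m-smooth ([x^m-1]^p≈x^[m*p]-1 p-prime m))
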